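{- For every agent $i$ and every formula $\phi$ of $\mathbf{LUT}$, $\vDash U_i\phi\to\bullet_iU_i\phi$, and consequently $\vDash U_i\phi\leftrightarrow\bullet_iU_i\phi$.
   Context: Let $\mathbf{P}$ be a countably infinite set of propositional variables and $\mathbf{I}$ a finite set of agents. The language $\mathbf{LUT}$ is given by $\phi::= p\mid\neg\phi\mid(\phi\land\phi)\mid K_i\phi\mid[\phi]\phi\mid U_i\phi$ ($p\in\mathbf{P}$, $i\in\mathbf{I}$); $\mathbf{EL}$ is the fragment without $[\cdot]$ and $U_i$. The abbreviation $\bullet_i\phi$ stands for $\phi\land\neg K_i\phi$. A model is $\mathcal{M}=\langle S,\{R_i\}_{i\in\mathbf{I}},V\rangle$ with $S\neq\emptyset$, each $R_i$ a reflexive relation on $S$, $V:\mathbf{P}\to2^S$. Truth: $p$ true at $s$ iff $s\in V(p)$; Boolean clauses as usual; $\mathcal{M},s\vDash K_i\phi$ iff $\phi$ holds at all $t$ with $sR_it$; $\mathcal{M},s\vDash[\psi]\phi$ iff ($\mathcal{M},s\vDash\psi$ implies $\mathcal{M}|_\psi,s\vDash\phi$), with $\mathcal{M}|_\psi$ the restriction of $\mathcal{M}$ to the states where $\psi$ is true; $\mathcal{M},s\vDash U_i\phi$ iff $\mathcal{M},s\vDash\phi$ and for all $\psi\in\mathbf{EL}$, $\mathcal{M},s\vDash[\psi]\neg K_i\phi$. $\vDash\phi$ means $\phi$ is true at every state of every model. -}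

module Defs where

open import Data.Nat using (ℕ)
open import Data.Fin using (Fin)
open import Data.Product using (Σ; _×_; _,_; proj₁)
open import Relation.Nullary using (¬_)
open import Relation.Binary.Core using (Rel)
open import Relation.Binary.Definitions using (Reflexive)

Prop : Set
Prop = ℕ

data LUT (n : ℕ) : Set where
  var  : Prop → LUT n
  ¬'_  : LUT n → LUT n
  _∧'_ : LUT n → LUT n → LUT n
  K    : Fin n → LUT n → LUT n
  [_]_ : LUT n → LUT n → LUT n
  U    : Fin n → LUT n → LUT n

data EL (n : ℕ) : Set where
  var  : Prop → EL n
  ¬'_  : EL n → EL n
  _∧'_ : EL n → EL n → EL n
  K    : Fin n → EL n → EL n

emb : ∀ {n} → EL n → LUT n
emb (var p)  = var p
emb (¬' φ)   = ¬' emb φ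
emb (φ ∧' ψ) = emb φ ∧' emb ψ
emb (K i φ)  = K i (emb φ)

record Model (n : ℕ) : Set₁ where
  field
    S      : Set
    inhab  : S
    R      : Fin n → Rel S _
    R-refl : ∀ i → Reflexive (R i)
    V      : Prop → S → Set
open Model public

-- Restriction of a model to the states satisfying a predicate, at a given
-- state satisfying it (guaranteeing nonemptiness).
restrict : ∀ {n} (M : Model n) (P : S M → Set) → Σ (S M) P → Model n
restrict M P s₀ = record
  { S      = Σ (S M) P
  ; inhab  = s₀
  ; R      = λ i x y → R M i (proj₁ x) (proj₁ y)
  ; R-refl = λ i → R-refl M i
  ; V      = λ p x → V M p (proj₁ x)
  }

_,_⊨EL_ : ∀ {n} (M : Model n) → S M → EL n → Set
M , s ⊨EL var p   = V M p s
M , s ⊨EL (¬' φ)  = ¬ (M , s ⊨EL φ)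
M , s ⊨EL (φ ∧' ψ) = (M , s ⊨EL φ) × (M , s ⊨EL ψ)
M , s ⊨EL K i φ   = ∀ t → R M i s t → M , t ⊨EL φ

_,_⊨_ : ∀ {n} (M : Model n) → S M → LUT n → Set
M , s ⊨ var p    = V M p s
M , s ⊨ (¬' φ)   = ¬ (M , s ⊨ φ)
M , s ⊨ (φ ∧' ψ) = (M , s ⊨ φ) × (M , s ⊨ ψ)
M , s ⊨ K i φ    = ∀ t → R M i s t → M , t ⊨ φ
M , s ⊨ ([ ψ ] φ) =
  (h : M , s ⊨ ψ) → restrict M (λ t → M , t ⊨ ψ) (s , h) , (s , h) ⊨ φ
-- U_i φ : φ holds and for every EL formula ψ, [ψ] ¬ K_i φ holds
-- (the clause for [ψ]¬K_i φ unfolded, so the recursion is structural).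
M , s ⊨ U i φ    =
  (M , s ⊨ φ) ×
  ((ψ : EL _) (h : M , s ⊨EL ψ) →
     let M' = restrict M (λ t → M , t ⊨EL ψ) (s , h) in
     ¬ (∀ t → R M' i (s , h) t → M' , t ⊨ φ))

_⇒_ : ∀ {n} → LUT n → LUT n → LUT n
φ ⇒ ψ = ¬' (φ ∧' (¬' ψ))

_⇔_ : ∀ {n} → LUT n → LUT n → LUT n
φ ⇔ ψ = (φ ⇒ ψ) ∧' (ψ ⇒ φ)

• : ∀ {n} → Fin n → LUT n → LUT n
• i φ = φ ∧' (¬' K i φ)

⊨_ : ∀ {n} → LUT n → Set₁
⊨_ {n} φ = (M : Model n) (s : S M) → M , s ⊨ φ

{-# OPTIONS --safe #-}
-- Uᵢφ entails φ and, by announcing a tautology, ¬Kᵢφ. Announcing a tautology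
-- leaves a model bisimilar to itself and LUT is bisimulation invariant, so
-- Kᵢ Uᵢφ would give Kᵢφ, contradicting ¬Kᵢφ; hence Uᵢφ holds but is not known.
module Submission where

open import Defs
open import Data.Nat using (ℕ)
open import Data.Fin using (Fin)
open import Data.Product using (Σ; _×_; _,_; proj₁; proj₂)
open import Relation.Nullary using (¬_)
open import Relation.Binary.PropositionalEquality using (_≡_; refl)

record Bisimulation {n : ℕ} (M N : Model n) : Set₁ where
  field
    Z        : S M → S N → Set
    var-forth : ∀ {s t} p → Z s t → V M p s → V N p t
    var-back  : ∀ {s t} p → Z s t → V N p t → V M p s
    forth    : ∀ {s t} i s′ → Z s t → R M i s s′ → Σ (S N) λ t′ → R N i t t′ × Z s′ t′
    back     : ∀ {s t} i t′ → Z s t → R N i t t′ → Σ (S M) λ s′ → R M i s s′ × Z s′ t′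
open Bisimulation

Bisimulation-sym : ∀ {n} {M N : Model n} → Bisimulation M N → Bisimulation N M
Bisimulation-sym B = record
  { Z         = λ t s → Z B s t
  ; var-forth = var-back B
  ; var-back  = var-forth B
  ; forth     = back B
  ; back      = forth B
  }

restrict-Bisimulation :
  ∀ {n} {M N : Model n} (B : Bisimulation M N) (P : S M → Set) (Q : S N → Set) →
  (∀ {s t} → Z B s t → P s → Q t) → (∀ {s t} → Z B s t → Q t → P s) →
  ∀ s₀ t₀ → Bisimulation (restrict M P s₀) (restrict N Q t₀)
restrict-Bisimulation B P Q P⇒Q Q⇒P s₀ t₀ = record
  { Z         = λ x y → Z B (proj₁ x) (proj₁ y)
  ; var-forth = var-forth B
  ; var-back  = var-back B
  ; forth     = λ i s′ z r → let (t′ , r′ , z′) = forth B i (proj₁ s′) z r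
                             in (t′ , P⇒Q z′ (proj₂ s′)) , r′ , z′
  ; back      = λ i t′ z r → let (s′ , r′ , z′) = back B i (proj₁ t′) z r
                             in (s′ , Q⇒P z′ (proj₂ t′)) , r′ , z′
  }

⊨EL-invariant : ∀ {n} (φ : EL n) {M N : Model n} (B : Bisimulation M N) {s t} →
  Z B s t → M , s ⊨EL φ → N , t ⊨EL φ
⊨EL-invariant (var p)  B z h       = var-forth B p z h
⊨EL-invariant (¬' φ)   B z h h′    = h (⊨EL-invariant φ (Bisimulation-sym B) z h′)
⊨EL-invariant (φ ∧' ψ) B z (a , b) = ⊨EL-invariant φ B z a , ⊨EL-invariant ψ B z b
⊨EL-invariant (K i φ)  B z h t′ r  =
  let (s′ , r′ , z′) = back B i t′ z r in ⊨EL-invariant φ B z′ (h s′ r′)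

⊨-invariant : ∀ {n} (φ : LUT n) {M N : Model n} (B : Bisimulation M N) {s t} →
  Z B s t → M , s ⊨ φ → N , t ⊨ φ
⊨-invariant (var p)  B z h       = var-forth B p z h
⊨-invariant (¬' φ)   B z h h′    = h (⊨-invariant φ (Bisimulation-sym B) z h′)
⊨-invariant (φ ∧' ψ) B z (a , b) = ⊨-invariant φ B z a , ⊨-invariant ψ B z b
⊨-invariant (K i φ)  B z h t′ r  =
  let (s′ , r′ , z′) = back B i t′ z r in ⊨-invariant φ B z′ (h s′ r′)
⊨-invariant ([ ψ ] φ) {M} {N} B {s} {t} z h ψᴺ = ⊨-invariant φ B|ψ z (h ψᴹ)
  where
  ψᴹ : M , s ⊨ ψ
  ψᴹ = ⊨-invariant ψ (Bisimulation-sym B) z ψᴺ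

  B|ψ : Bisimulation (restrict M (λ u → M , u ⊨ ψ) (s , ψᴹ))
                     (restrict N (λ u → N , u ⊨ ψ) (t , ψᴺ))
  B|ψ = restrict-Bisimulation B _ _
          (⊨-invariant ψ B) (⊨-invariant ψ (Bisimulation-sym B)) (s , ψᴹ) (t , ψᴺ)
⊨-invariant (U i φ) {M} {N} B {s} {t} z (φᴹ , ¬Kᴹ) =
  ⊨-invariant φ B z φᴹ , ¬Kᴺ
  where
  ¬Kᴺ : (ψ : EL _) (ψᴺ : N , t ⊨EL ψ) →
        let N|ψ = restrict N (λ u → N , u ⊨EL ψ) (t , ψᴺ) in
        ¬ (∀ t′ → R N|ψ i (t , ψᴺ) t′ → N|ψ , t′ ⊨ φ)
  ¬Kᴺ ψ ψᴺ Kᴺ = ¬Kᴹ ψ ψᴹ λ s′ r →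
    let (t′ , r′ , z′) = forth B|ψ {s , ψᴹ} {t , ψᴺ} i s′ z r
    in ⊨-invariant φ (Bisimulation-sym B|ψ) z′ (Kᴺ t′ r′)
    where
    ψᴹ : M , s ⊨EL ψ
    ψᴹ = ⊨EL-invariant ψ (Bisimulation-sym B) z ψᴺ

    B|ψ : Bisimulation (restrict M (λ u → M , u ⊨EL ψ) (s , ψᴹ))
                       (restrict N (λ u → N , u ⊨EL ψ) (t , ψᴺ))
    B|ψ = restrict-Bisimulation B _ _
            (⊨EL-invariant ψ B) (⊨EL-invariant ψ (Bisimulation-sym B)) (s , ψᴹ) (t , ψᴺ)

restrict-valid-Bisimulation : ∀ {n} (M : Model n) (P : S M → Set) →
  (∀ s → P s) → ∀ s₀ → Bisimulation M (restrict M P s₀)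
restrict-valid-Bisimulation M P valid s₀ = record
  { Z         = λ s x → s ≡ proj₁ x
  ; var-forth = λ { p refl v → v }
  ; var-back  = λ { p refl v → v }
  ; forth     = λ { i s′ refl r → (s′ , valid s′) , r , refl }
  ; back      = λ { i t′ refl r → proj₁ t′ , r , refl }
  }

⊤ᴱᴸ : ∀ {n} → EL n
⊤ᴱᴸ = ¬' (var 0 ∧' (¬' var 0))

⊨EL-⊤ : ∀ {n} (M : Model n) s → M , s ⊨EL ⊤ᴱᴸ
⊨EL-⊤ M s (v , ¬v) = ¬v v

U⇒¬K : ∀ {n} (M : Model n) s i φ → M , s ⊨ U i φ → ¬ (M , s ⊨ K i φ)
U⇒¬K M s i φ (_ , ¬K) Kφ = ¬K ⊤ᴱᴸ (⊨EL-⊤ M s) λ t r →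
  ⊨-invariant φ (restrict-valid-Bisimulation M _ (⊨EL-⊤ M) (s , ⊨EL-⊤ M s)) refl
    (Kφ (proj₁ t) r)

U⇒•U : ∀ {n} (M : Model n) s i φ → M , s ⊨ U i φ → M , s ⊨ • i (U i φ)
U⇒•U M s i φ Uφ = Uφ , λ KUφ → U⇒¬K M s i φ Uφ λ t r → proj₁ (KUφ t r)

⊨⇒-intro : ∀ {n} {φ ψ : LUT n} → (∀ M s → M , s ⊨ φ → M , s ⊨ ψ) → ⊨ (φ ⇒ ψ)
⊨⇒-intro φ→ψ M s (φˢ , ¬ψˢ) = ¬ψˢ (φ→ψ M s φˢ)

mainTheorem13 : (n : ℕ) (i : Fin n) (φ : LUT n) →
    (⊨ (U i φ ⇒ • i (U i φ))) × (⊨ (U i φ ⇔ • i (U i φ)))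
mainTheorem13 n i φ = U⇒•U-valid , λ M s → U⇒•U-valid M s , •U⇒U-valid M s
  where
  U⇒•U-valid : ⊨ (U i φ ⇒ • i (U i φ))
  U⇒•U-valid = ⊨⇒-intro {φ = U i φ} {ψ = • i (U i φ)} λ M s → U⇒•U M s i φ

  •U⇒U-valid : ⊨ (• i (U i φ) ⇒ U i φ)
  •U⇒U-valid = ⊨⇒-intro {φ = • i (U i φ)} {ψ = U i φ} λ M s → proj₁
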